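{- In the exploration model with recoloring described in the context, there exists an algorithm that only ever assigns colors from a fixed set of $7$ nonzero colors and that successfully explores every finite connected graph.
   Context: Exploration model with recoloring. Graphs are finite, simple, undirected and connected; vertices are anonymous and edges carry no port labels. Each vertex carries a color in $\mathbb{N}=\{0,1,2,\dots\}$, where $0$ means "uncolored"; initially all vertices have color $0$. An algorithm is a function $\mathrm{move}$ mapping every environment $(c_0,E)$ — where $c_0\in\mathbb{N}$ is the color of the agent's current vertex and $E:\mathbb{N}\to\mathbb{N}$ (zero almost everywhere) gives, for each color $c$, the number $E(c)$ of neighbors of the current vertex having color $c$ — either to $\mathrm{Stop}$ or to a pair $(c_1,d)\in\mathbb{N}\times\mathbb{N}$ with $E(d)>0$; here $c_1$ may be arbitrary, i.e., already colored vertices may be recolored. A run on a graph $G$: an adversary chooses a start vertex $v_0$ and places the agent there; in each step, with the agent at $v$, $\mathrm{move}$ is evaluated at the environment of $v$; if the value is $\mathrm{Stop}$ the run ends, and if it is $(c_1,d)$ then $v$ receives color $c_1$ and the adversary chooses an arbitrary neighbor of $v$ of color $d$, to which the agent moves. The agent has no other memory. A vertex is visited if the agent is located at it in some step. An algorithm successfully explores $G$ if for every adversary (every choice of start vertex and of neighbors), after finitely many steps all vertices have been visited, the agent is at $v_0$, and the decision is $\mathrm{Stop}$. -}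

module Defs where

open import Data.Nat using (ℕ; zero; suc; _+_; _<_; _≡ᵇ_)
open import Data.Bool using (Bool; true; false; _∧_; if_then_else_)
open import Data.Fin using (Fin; _≟_) renaming (zero to fzero; suc to fsuc)
open import Data.Maybe using (Maybe; just; nothing)
open import Data.Product using (_×_; _,_; Σ; ∃)
open import Data.List using (List; []; _∷_)
open import Data.List.Membership.Propositional using (_∈_)
open import Relation.Nullary using (does; ¬_)
open import Relation.Binary.PropositionalEquality using (_≡_)

count : ∀ {n} → (Fin n → Bool) → ℕ
count {zero}  p = 0
count {suc n} p = (if p fzero then 1 else 0) + count (λ i → p (fsuc i))

data Path {n : ℕ} (adj : Fin n → Fin n → Bool) : Fin n → Fin n → Set where
  here : ∀ {u} → Path adj u u
  step : ∀ {u v w} → adj u v ≡ true → Path adj v w → Path adj u w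

record Graph : Set where
  field
    n         : ℕ
    adj       : Fin n → Fin n → Bool
    symmetric : ∀ u v → adj u v ≡ adj v u
    irreflex  : ∀ u → adj u u ≡ false
    connected : ∀ u v → Path adj u v

-- Algorithms.  An environment is (c₀ , E) with E : ℕ → ℕ;
-- the result `nothing` means Stop, `just (c₁ , d)` means recolor
-- the current vertex with c₁ and move to some neighbor of color d.

Move : Set
Move = ℕ → (ℕ → ℕ) → Maybe (ℕ × ℕ)

record Algorithm : Set where
  field
    move  : Move
    valid : ∀ c₀ E c₁ d → move c₀ E ≡ just (c₁ , d) → 0 < E d

open Algorithm public

UsesOnly : Algorithm → ∀ {k} → (Fin k → ℕ) → Set
UsesOnly A S = ∀ c₀ E c₁ d → move A c₀ E ≡ just (c₁ , d) → ∃ λ i → S i ≡ c₁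

module _ (G : Graph) where
  open Graph G

  Coloring : Set
  Coloring = Fin n → ℕ

  env : Coloring → Fin n → ℕ → ℕ
  env col v c = count (λ u → adj v u ∧ (col u ≡ᵇ c))

  recolor : Coloring → Fin n → ℕ → Coloring
  recolor col v c u = if does (u ≟ v) then c else col u

  -- Good A v₀ vis col v : from the configuration where the agent is at v,
  -- the coloring is col and the visited vertices so far are vis, every
  -- adversary leads after finitely many steps to Stop at v₀ with all
  -- vertices visited.  (Inductive, i.e. well-founded, game tree.)
  data Good (A : Algorithm) (v₀ : Fin n) : List (Fin n) → Coloring → Fin n → Set where
    stop : ∀ {vis col v} →
           move A (col v) (env col v) ≡ nothing →
           (∀ u → u ∈ vis) →
           v ≡ v₀ →
           Good A v₀ vis col v
    go   : ∀ {vis col v c₁ d} →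
           move A (col v) (env col v) ≡ just (c₁ , d) →
           (∀ w → adj v w ≡ true → col w ≡ d →
                  Good A v₀ (w ∷ vis) (recolor col v c₁) w) →
           Good A v₀ vis col v

  Explores : Algorithm → Set
  Explores A = ∀ v₀ → Good A v₀ (v₀ ∷ []) (λ _ → 0) v₀

module Submission where

-- The explorer runs an iterative-deepening search from the start vertex v₀. A labelled vertex
-- stores its distance to v₀ modulo 3, which lets it tell its parent (previous label) from its
-- children (next label), together with a phase bit. In the phase of radius r a depth-first walk
-- through the ball of radius r, following the labels, discovers and labels the uncoloured vertices
-- at distance r + 1; a vertex retreating to its parent flips its bit if a flipped child remains
-- below it and otherwise becomes finished (colour 7), so that the bit flip at v₀ starts the next
-- phase with all labelled vertices pending again. When v₀ has neither an uncoloured neighbour nor a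
-- child to enter or flip to, every vertex reachable from v₀ is coloured, hence visited.
-- Termination: the total weight (2 per uncoloured, 1 per labelled, 0 per finished vertex) never
-- grows and drops in every phase, and within a phase the weight of pending and uncoloured vertices
-- plus the remaining depth r + 1 − δ of the agent drops at every move.

open import Defs
open import Data.Bool using (Bool; true; false; _∧_; _∨_; not; if_then_else_)
open import Data.Bool.Properties using (not-involutive; not-¬; T-≡; ∨-zeroʳ) renaming (_≟_ to _≟B_)
open import Data.Empty using (⊥; ⊥-elim)
open import Data.Fin using (Fin; toℕ) renaming (zero to fzero; suc to fsuc; _≟_ to _≟F_)
open import Data.Fin.Properties using () renaming (suc-injective to fsuc-injective)
open import Data.List using (List; []; _∷_)
open import Data.List.Membership.Propositional using (_∈_)
open import Data.List.Relation.Unary.Any using (here; there)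
open import Data.Maybe using (Maybe; just; nothing)
open import Data.Nat using (ℕ; zero; suc; _+_; _∸_; _≤_; _<_; z≤n; s≤s; _≡ᵇ_; _≤ᵇ_)
open import Data.Nat.Properties
  using (≤-trans; ≤-refl; n≤1+n; <-irrefl; ≤-antisym; +-comm; +-assoc; +-suc; +-identityʳ; +-cancelʳ-≡;
         +-∸-assoc; m+n∸n≡m; m≤m+n; n≤0⇒n≡0; _≤?_; ≰⇒>; ≤-pred; ≤∧≢⇒<; m≤n⇒m<n∨m≡n; suc-injective; 0≢1+n;
         ≡ᵇ⇒≡; ≡⇒≡ᵇ)
  renaming (_≟_ to _≟ℕ_)
open import Data.Product using (Σ; _×_; _,_; ∃; proj₁; proj₂; map₂)
open import Data.Product.Properties using (≡-dec)
open import Data.Sum using (_⊎_; inj₁; inj₂)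
open import Function.Base using (_∘_)
open import Function.Bundles using (Equivalence)
open import Relation.Binary.Definitions using (DecidableEquality)
open import Relation.Binary.PropositionalEquality
  using (_≡_; refl; sym; trans; cong; cong₂; subst; _≢_; module ≡-Reasoning)
open import Relation.Nullary using (¬_; does; yes; no)

data Label : Set where
  ℓ₀ ℓ₁ ℓ₂ : Label

next : Label → Label
next ℓ₀ = ℓ₁
next ℓ₁ = ℓ₂
next ℓ₂ = ℓ₀

prev : Label → Label
prev ℓ₀ = ℓ₂
prev ℓ₁ = ℓ₀
prev ℓ₂ = ℓ₁

label : ℕ → Label
label zero    = ℓ₀
label (suc d) = next (label d)

next-≢ : ∀ x → next x ≢ x
next-≢ ℓ₀ ()
next-≢ ℓ₁ ()
next-≢ ℓ₂ ()

next²-≢ : ∀ x → next (next x) ≢ x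
next²-≢ ℓ₀ ()
next²-≢ ℓ₁ ()
next²-≢ ℓ₂ ()

next≢prev : ∀ x → next x ≢ prev x
next≢prev ℓ₀ ()
next≢prev ℓ₁ ()
next≢prev ℓ₂ ()

prev≡next² : ∀ x → prev x ≡ next (next x)
prev≡next² ℓ₀ = refl
prev≡next² ℓ₁ = refl
prev≡next² ℓ₂ = refl

prev-next : ∀ x → prev (next x) ≡ x
prev-next ℓ₀ = refl
prev-next ℓ₁ = refl
prev-next ℓ₂ = refl

≤1-apart : ∀ a b → a ≤ suc b → b ≤ suc a → a ≡ b ⊎ a ≡ suc b ⊎ suc a ≡ b
≤1-apart zero          zero          _       _       = inj₁ refl
≤1-apart zero          (suc zero)    _       _       = inj₂ (inj₂ refl)
≤1-apart (suc zero)    zero          _       _       = inj₂ (inj₁ refl)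
≤1-apart zero          (suc (suc b)) _       (s≤s ())
≤1-apart (suc (suc a)) zero          (s≤s ()) _
≤1-apart (suc a)       (suc b)       (s≤s p) (s≤s q) with ≤1-apart a b p q
... | inj₁ e         = inj₁ (cong suc e)
... | inj₂ (inj₁ e) = inj₂ (inj₁ (cong suc e))
... | inj₂ (inj₂ e) = inj₂ (inj₂ (cong suc e))

-- Labels are distances mod 3, so they tell apart numbers that differ by at most one.
label-≡ : ∀ a b → a ≤ suc b → b ≤ suc a → label a ≡ label b → a ≡ b
label-≡ a b p q e with ≤1-apart a b p q
... | inj₁ a≡b          = a≡b
... | inj₂ (inj₁ refl) = ⊥-elim (next-≢ (label b) e)
... | inj₂ (inj₂ refl) = ⊥-elim (next-≢ (label a) (sym e))

label-next : ∀ a b → a ≤ suc b → b ≤ suc a → label a ≡ next (label b) → a ≡ suc b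
label-next a b p q e with ≤1-apart a b p q
... | inj₁ refl          = ⊥-elim (next-≢ (label b) (sym e))
... | inj₂ (inj₁ a≡1+b) = a≡1+b
... | inj₂ (inj₂ refl)   = ⊥-elim (next²-≢ (label a) (sym e))

label-prev : ∀ a b → a ≤ suc b → b ≤ suc a → label a ≡ prev (label b) → suc a ≡ b
label-prev a b p q e with ≤1-apart a b p q
... | inj₁ refl          = ⊥-elim (next²-≢ (label b) (sym (trans e (prev≡next² (label b)))))
... | inj₂ (inj₁ refl)   = ⊥-elim (next≢prev (label b) e)
... | inj₂ (inj₂ 1+a≡b) = 1+a≡b

-- Colours 1–6 encode a pair (label, phase bit); colour 7 marks a vertex whose subtree is finished.
code : Label → Bool → ℕ
code ℓ₀ false = 1
code ℓ₁ false = 2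
code ℓ₂ false = 3
code ℓ₀ true  = 4
code ℓ₁ true  = 5
code ℓ₂ true  = 6

finished : ℕ
finished = 7

nonzero : ℕ → Bool
nonzero zero    = false
nonzero (suc _) = true

retreatColour : Label → Bool → Bool → ℕ
retreatColour l b true  = code l (not b)
retreatColour l b false = finished

-- The move from a vertex coloured code l b, given which of the colours
-- 0, code (next l) b, code (prev l) b and code (next l) (not b) occur around it.
labelledMove : Label → Bool → Bool → Bool → Bool → Bool → Maybe (ℕ × ℕ)
labelledMove l b true  _     _     _     = just (code l b , 0)
labelledMove l b false true  _     _     = just (code l b , code (next l) b)
labelledMove l b false false true  q     = just (retreatColour l b q , code (prev l) b)
labelledMove l b false false false true  = just (code l (not b) , code (next l) (not b))
labelledMove l b false false false false = nothing

firstIf : Bool → Bool → Label × Bool → Maybe (Label × Bool) → Maybe (Label × Bool)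
firstIf true false p _    = just p
firstIf _    _     _ rest = rest

-- The first (l , b) present around an uncoloured vertex whose colour code (prev l) (not b) is absent.
parentLabel : (Label → Bool → Bool) → Maybe (Label × Bool)
parentLabel present =
  firstIf (present ℓ₀ false) (present ℓ₂ true)  (ℓ₀ , false)
  (firstIf (present ℓ₁ false) (present ℓ₀ true)  (ℓ₁ , false)
  (firstIf (present ℓ₂ false) (present ℓ₁ true)  (ℓ₂ , false)
  (firstIf (present ℓ₀ true)  (present ℓ₂ false) (ℓ₀ , true)
  (firstIf (present ℓ₁ true)  (present ℓ₀ false) (ℓ₁ , true)
  (firstIf (present ℓ₂ true)  (present ℓ₁ false) (ℓ₂ , true) nothing)))))

uncolouredMove : Maybe (Label × Bool) → Bool → Maybe (ℕ × ℕ)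
uncolouredMove (just (l , b)) _     = just (code (next l) (not b) , code l b)
uncolouredMove nothing        true  = just (code ℓ₀ false , 0)
uncolouredMove nothing        false = nothing

labelledDecision : Label → Bool → (ℕ → ℕ) → Maybe (ℕ × ℕ)
labelledDecision l b E =
  labelledMove l b (nonzero (E 0)) (nonzero (E (code (next l) b))) (nonzero (E (code (prev l) b)))
                   (nonzero (E (code (next l) (not b))))

decide : ℕ → (ℕ → ℕ) → Maybe (ℕ × ℕ)
decide 0 E = uncolouredMove (parentLabel λ l b → nonzero (E (code l b))) (nonzero (E 0))
decide 1 E = labelledDecision ℓ₀ false E
decide 2 E = labelledDecision ℓ₁ false E
decide 3 E = labelledDecision ℓ₂ false E
decide 4 E = labelledDecision ℓ₀ true  E
decide 5 E = labelledDecision ℓ₁ true  E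
decide 6 E = labelledDecision ℓ₂ true  E
decide _ E = nothing

inPalette : ℕ → Bool
inPalette c = nonzero c ∧ (c ≤ᵇ 7)

-- Filtering the decision makes validity and the palette bound hold by construction;
-- the correctness proof shows the filter never fires.
guard : (ℕ → ℕ) → Maybe (ℕ × ℕ) → Maybe (ℕ × ℕ)
guard E nothing        = nothing
guard E (just (c , d)) = if nonzero (E d) ∧ inPalette c then just (c , d) else nothing

explorerMove : Move
explorerMove c₀ E = guard E (decide c₀ E)

guard-sound : ∀ E x c d → guard E x ≡ just (c , d) → nonzero (E d) ≡ true × inPalette c ≡ true
guard-sound E (just (c' , d')) c d eq with nonzero (E d') in p | inPalette c' in q
guard-sound E (just (c' , d')) c d refl | true | true = p , q

nonzero⇒0< : ∀ x → nonzero x ≡ true → 0 < x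
nonzero⇒0< (suc x) _ = s≤s z≤n

explorer : Algorithm
explorer = record
  { move  = explorerMove
  ; valid = λ c₀ E c d eq → nonzero⇒0< (E d) (proj₁ (guard-sound E (decide c₀ E) c d eq)) }

palette : Fin 7 → ℕ
palette i = suc (toℕ i)

palette-covers : ∀ c → inPalette c ≡ true → ∃ λ i → palette i ≡ c
palette-covers 1 _ = fzero , refl
palette-covers 2 _ = fsuc fzero , refl
palette-covers 3 _ = fsuc (fsuc fzero) , refl
palette-covers 4 _ = fsuc (fsuc (fsuc fzero)) , refl
palette-covers 5 _ = fsuc (fsuc (fsuc (fsuc fzero))) , refl
palette-covers 6 _ = fsuc (fsuc (fsuc (fsuc (fsuc fzero)))) , refl
palette-covers 7 _ = fsuc (fsuc (fsuc (fsuc (fsuc (fsuc fzero))))) , refl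

explorer-usesOnly-palette : UsesOnly explorer palette
explorer-usesOnly-palette c₀ E c d eq = palette-covers c (proj₂ (guard-sound E (decide c₀ E) c d eq))

decode : ℕ → Label × Bool
decode 2 = ℓ₁ , false
decode 3 = ℓ₂ , false
decode 4 = ℓ₀ , true
decode 5 = ℓ₁ , true
decode 6 = ℓ₂ , true
decode _ = ℓ₀ , false

decode-code : ∀ l b → decode (code l b) ≡ (l , b)
decode-code ℓ₀ false = refl
decode-code ℓ₁ false = refl
decode-code ℓ₂ false = refl
decode-code ℓ₀ true  = refl
decode-code ℓ₁ true  = refl
decode-code ℓ₂ true  = refl

code-injective : ∀ {l b l' b'} → code l b ≡ code l' b' → l ≡ l' × b ≡ b'
code-injective {l} {b} {l'} {b'} eq
  with trans (sym (decode-code l b)) (trans (cong decode eq) (decode-code l' b'))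
... | refl = refl , refl

code≢0 : ∀ l b → code l b ≢ 0
code≢0 ℓ₀ false ()
code≢0 ℓ₁ false ()
code≢0 ℓ₂ false ()
code≢0 ℓ₀ true  ()
code≢0 ℓ₁ true  ()
code≢0 ℓ₂ true  ()

code≢finished : ∀ l b → code l b ≢ finished
code≢finished ℓ₀ false ()
code≢finished ℓ₁ false ()
code≢finished ℓ₂ false ()
code≢finished ℓ₀ true  ()
code≢finished ℓ₁ true  ()
code≢finished ℓ₂ true  ()

code-inPalette : ∀ l b → inPalette (code l b) ≡ true
code-inPalette ℓ₀ false = refl
code-inPalette ℓ₁ false = refl
code-inPalette ℓ₂ false = refl
code-inPalette ℓ₀ true  = refl
code-inPalette ℓ₁ true  = refl
code-inPalette ℓ₂ true  = refl

retreatColour-inPalette : ∀ l b t → inPalette (retreatColour l b t) ≡ true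
retreatColour-inPalette l b true  = code-inPalette l (not b)
retreatColour-inPalette l b false = refl

decide-code : ∀ l b E → decide (code l b) E ≡ labelledDecision l b E
decide-code ℓ₀ false E = refl
decide-code ℓ₁ false E = refl
decide-code ℓ₂ false E = refl
decide-code ℓ₀ true  E = refl
decide-code ℓ₁ true  E = refl
decide-code ℓ₂ true  E = refl

guard-pass : ∀ E c d → nonzero (E d) ≡ true → inPalette c ≡ true → guard E (just (c , d)) ≡ just (c , d)
guard-pass E c d p q rewrite p | q = refl

_≟ℓ_ : DecidableEquality Label
ℓ₀ ≟ℓ ℓ₀ = yes refl
ℓ₁ ≟ℓ ℓ₁ = yes refl
ℓ₂ ≟ℓ ℓ₂ = yes refl
ℓ₀ ≟ℓ ℓ₁ = no λ ()
ℓ₀ ≟ℓ ℓ₂ = no λ ()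
ℓ₁ ≟ℓ ℓ₀ = no λ ()
ℓ₁ ≟ℓ ℓ₂ = no λ ()
ℓ₂ ≟ℓ ℓ₀ = no λ ()
ℓ₂ ≟ℓ ℓ₁ = no λ ()

twoPoint : Label × Bool → Label × Bool → Bool → Label → Bool → Bool
twoPoint p p' s l b =
  if does (≡-dec _≟ℓ_ _≟B_ (l , b) p) then true else if does (≡-dec _≟ℓ_ _≟B_ (l , b) p') then s else false

parentLabel-twoPoint : ∀ l b s → parentLabel (twoPoint (l , b) (next l , not b) s) ≡ just (l , b)
parentLabel-twoPoint ℓ₀ false false = refl
parentLabel-twoPoint ℓ₁ false false = refl
parentLabel-twoPoint ℓ₂ false false = refl
parentLabel-twoPoint ℓ₀ true  false = refl
parentLabel-twoPoint ℓ₁ true  false = refl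
parentLabel-twoPoint ℓ₂ true  false = refl
parentLabel-twoPoint ℓ₀ false true  = refl
parentLabel-twoPoint ℓ₁ false true  = refl
parentLabel-twoPoint ℓ₂ false true  = refl
parentLabel-twoPoint ℓ₀ true  true  = refl
parentLabel-twoPoint ℓ₁ true  true  = refl
parentLabel-twoPoint ℓ₂ true  true  = refl

parentLabel-cong : ∀ q q' → (∀ l b → q l b ≡ q' l b) → parentLabel q ≡ parentLabel q'
parentLabel-cong q q' h
  rewrite h ℓ₀ false | h ℓ₁ false | h ℓ₂ false | h ℓ₀ true | h ℓ₁ true | h ℓ₂ true = refl

twoPoint-unique : ∀ (q : Label → Bool → Bool) l₀ b₀ p' → q l₀ b₀ ≡ true →
                  (∀ l b → q l b ≡ true → (l , b) ≡ (l₀ , b₀) ⊎ (l , b) ≡ p') →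
                  ∀ l b → q l b ≡ twoPoint (l₀ , b₀) p' (q (proj₁ p') (proj₂ p')) l b
twoPoint-unique q l₀ b₀ p' q₀ only l b with ≡-dec _≟ℓ_ _≟B_ (l , b) (l₀ , b₀)
... | yes refl = q₀
... | no ≢p₀ with ≡-dec _≟ℓ_ _≟B_ (l , b) p'
...   | yes refl = refl
...   | no ≢p' with q l b in e
...     | false = refl
...     | true with only l b e
...       | inj₁ ≡p₀ = ⊥-elim (≢p₀ ≡p₀)
...       | inj₂ ≡p' = ⊥-elim (≢p' ≡p')

parentLabel-unique : ∀ (q : Label → Bool → Bool) l b → q l b ≡ true →
                     (∀ l' b' → q l' b' ≡ true → (l' , b') ≡ (l , b) ⊎ (l' , b') ≡ (next l , not b)) →
                     parentLabel q ≡ just (l , b)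
parentLabel-unique q l b q₀ only =
  trans (parentLabel-cong q _ (twoPoint-unique q l b (next l , not b) q₀ only)) (parentLabel-twoPoint l b _)

parentLabel-none : ∀ q → (∀ l b → q l b ≡ false) → parentLabel q ≡ nothing
parentLabel-none q none = parentLabel-cong q (λ _ _ → false) none

count-nonzero : ∀ {n} (p : Fin n → Bool) u → p u ≡ true → nonzero (count p) ≡ true
count-nonzero p fzero    e rewrite e = refl
count-nonzero p (fsuc u) e with p fzero
... | true  = refl
... | false = count-nonzero (λ i → p (fsuc i)) u e

count-witness : ∀ {n} (p : Fin n → Bool) → nonzero (count p) ≡ true → ∃ λ u → p u ≡ true
count-witness {zero}  p ()
count-witness {suc n} p e with p fzero in eq
... | true  = fzero , eq
... | false with count-witness (λ i → p (fsuc i)) e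
...   | u , e' = fsuc u , e'

∧-true : ∀ a b → (a ∧ b) ≡ true → a ≡ true × b ≡ true
∧-true true true _ = refl , refl

true≢false : ∀ {b} → b ≡ true → b ≢ false
true≢false refl ()

-- The least j with p j, provided p K holds (junk otherwise).
leastBelow : (ℕ → Bool) → ℕ → ℕ
leastBelow p zero    = 0
leastBelow p (suc K) = if p 0 then 0 else suc (leastBelow (λ j → p (suc j)) K)

leastBelow-holds : ∀ (p : ℕ → Bool) K → p K ≡ true → p (leastBelow p K) ≡ true
leastBelow-holds p zero    e = e
leastBelow-holds p (suc K) e with p 0 in eq
... | true  = eq
... | false = leastBelow-holds (λ j → p (suc j)) K e

leastBelow-minimal : ∀ (p : ℕ → Bool) K j → p j ≡ true → leastBelow p K ≤ j
leastBelow-minimal p zero    j       e = z≤n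
leastBelow-minimal p (suc K) j       e with p 0 in eq
leastBelow-minimal p (suc K) j       e | true  = z≤n
leastBelow-minimal p (suc K) zero    e | false = ⊥-elim (true≢false e eq)
leastBelow-minimal p (suc K) (suc j) e | false = s≤s (leastBelow-minimal (λ j → p (suc j)) K j e)

below-leastBelow : ∀ (p : ℕ → Bool) K j → suc j ≤ leastBelow p K → p j ≡ false
below-leastBelow p (suc K) j       lt       with p 0 in eq
below-leastBelow p (suc K) zero    lt       | false = eq
below-leastBelow p (suc K) (suc j) (s≤s lt) | false = below-leastBelow (λ j → p (suc j)) K j lt

sumFin : ∀ {n} → (Fin n → ℕ) → ℕ
sumFin {zero}  f = 0
sumFin {suc n} f = f fzero + sumFin (λ i → f (fsuc i))

sumFin-cong : ∀ {n} {f g : Fin n → ℕ} → (∀ u → f u ≡ g u) → sumFin f ≡ sumFin g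
sumFin-cong {zero}  h = refl
sumFin-cong {suc n} h = cong₂ _+_ (h fzero) (sumFin-cong (λ i → h (fsuc i)))

-- Changing a summand at y: stated with both sides moved so that no subtraction occurs.
sumFin-update : ∀ {n} (f f' : Fin n → ℕ) y → (∀ u → u ≢ y → f' u ≡ f u) →
                sumFin f' + f y ≡ sumFin f + f' y
sumFin-update f f' fzero h
  rewrite sumFin-cong {f = λ i → f' (fsuc i)} {g = λ i → f (fsuc i)} (λ i → h (fsuc i) λ ())
  = swap (f' fzero) (sumFin (λ i → f (fsuc i))) (f fzero)
  where
  swap : ∀ a s b → a + s + b ≡ b + s + a
  swap a s b rewrite +-comm a s | +-assoc s a b | +-comm a b | +-comm b s | +-assoc s b a = refl
sumFin-update f f' (fsuc y) h rewrite h fzero (λ ()) =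
  trans (+-assoc (f fzero) _ _)
   (trans (cong (f fzero +_) (sumFin-update (λ i → f (fsuc i)) (λ i → f' (fsuc i)) y
                                (λ u u≢y → h (fsuc u) λ e → u≢y (fsuc-injective e))))
     (sym (+-assoc (f fzero) _ _)))

no-ascending-chain : ∀ {A : Set} (f : A → ℕ) (Q : A → Set) B →
                     (∀ u → Q u → ∃ λ w → Q w × f w ≡ suc (f u)) → (∀ u → Q u → f u ≤ B) → ∀ u → ¬ Q u
no-ascending-chain {A} f Q B up bounded u q = climb (suc B) u q (s≤s (m≤m+n B (f u)))
  where
  climb : ∀ k u → Q u → B < k + f u → ⊥
  climb zero    u q lt = <-irrefl refl (≤-trans lt (bounded u q))
  climb (suc k) u q lt with up u q
  ... | w , qw , fw = climb k w qw (subst (B <_) (trans (sym (+-suc k (f u))) (cong (k +_) (sym fw))) lt)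

+-suc-cancel-< : ∀ a b k → a + suc k ≡ b + k → a < b
+-suc-cancel-< a b k e = subst (suc a ≤_) (+-cancelʳ-≡ k (suc a) b (trans (sym (+-suc a k)) e)) ≤-refl

+-suc-<-pred : ∀ a t k → a + suc t < suc k → a + t < k
+-suc-<-pred a t k lt = subst (_≤ k) (+-suc a t) (≤-pred lt)

spend-two : ∀ a b t k → a + 2 ≡ b → b + t < suc k → a + suc t < k
spend-two a b t k e lt = subst (_≤ k) (sym shift) (≤-pred lt)
  where
  shift : suc (a + suc t) ≡ b + t
  shift = trans (sym (+-suc a (suc t))) (trans (sym (+-assoc a 2 t)) (cong (_+ t) e))

≤∧≤1+⇒≡∨≡1+ : ∀ {r d} → r ≤ d → d ≤ suc r → d ≡ r ⊎ d ≡ suc r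
≤∧≤1+⇒≡∨≡1+ r≤d d≤1+r with m≤n⇒m<n∨m≡n r≤d
... | inj₁ r<d = inj₂ (≤-antisym d≤1+r r<d)
... | inj₂ r≡d = inj₁ (sym r≡d)

module _ {n : ℕ} (adj : Fin n → Fin n → Bool) where

  Path-closed : (P : Fin n → Set) → (∀ v u → P v → adj v u ≡ true → P u) → ∀ {a b} → Path adj a b → P a → P b
  Path-closed P closed here        pa = pa
  Path-closed P closed (step e p) pa = Path-closed P closed p (closed _ _ pa e)

module GraphFacts (G : Graph) where
  open Graph G

  adj-sym : ∀ {u w} → adj u w ≡ true → adj w u ≡ true
  adj-sym {u} {w} a = trans (symmetric w u) a

  adj⇒≢ : ∀ {u w} → adj u w ≡ true → u ≢ w
  adj⇒≢ {u} a refl = true≢false a (irreflex u)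

  present : Coloring G → Fin n → ℕ → Bool
  present col v c = nonzero (env G col v c)

  neighbour⇒present : ∀ col v u c → adj v u ≡ true → col u ≡ c → present col v c ≡ true
  neighbour⇒present col v u c a refl =
    count-nonzero _ u (cong₂ _∧_ a (Equivalence.to T-≡ (≡⇒≡ᵇ (col u) (col u) refl)))

  present⇒neighbour : ∀ col v c → present col v c ≡ true → ∃ λ u → adj v u ≡ true × col u ≡ c
  present⇒neighbour col v c e with count-witness _ e
  ... | u , e' with ∧-true _ _ e'
  ...   | a , b = u , a , ≡ᵇ⇒≡ (col u) c (Equivalence.from T-≡ b)

  ¬present⇒¬neighbour : ∀ col v u c → present col v c ≡ false → adj v u ≡ true → col u ≢ c
  ¬present⇒¬neighbour col v u c f a e = true≢false (neighbour⇒present col v u c a e) f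

  ¬neighbour⇒¬present : ∀ col v c → (∀ u → adj v u ≡ true → col u ≢ c) → present col v c ≡ false
  ¬neighbour⇒¬present col v c none with present col v c in e
  ... | false = refl
  ... | true with present⇒neighbour col v c e
  ...   | u , a , cu = ⊥-elim (none u a cu)

  recolor-same : ∀ col v c → recolor G col v c v ≡ c
  recolor-same col v c with v ≟F v
  ... | yes _   = refl
  ... | no v≢v = ⊥-elim (v≢v refl)

  recolor-other : ∀ col v c u → u ≢ v → recolor G col v c u ≡ col u
  recolor-other col v c u u≢v with u ≟F v
  ... | yes u≡v = ⊥-elim (u≢v u≡v)
  ... | no _    = refl

module Distance (G : Graph) (v₀ : Fin (Graph.n G)) where
  open Graph G
  open GraphFacts G

  within : ℕ → Fin n → Bool
  within zero    v = does (v ≟F v₀)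
  within (suc k) v = within k v ∨ nonzero (count λ u → adj v u ∧ within k u)

  within-root : within 0 v₀ ≡ true
  within-root with v₀ ≟F v₀
  ... | yes _     = refl
  ... | no v₀≢v₀ = ⊥-elim (v₀≢v₀ refl)

  within-zero : ∀ v → within 0 v ≡ true → v ≡ v₀
  within-zero v e with v ≟F v₀
  ... | yes v≡v₀ = v≡v₀

  within-step : ∀ k v u → adj v u ≡ true → within k u ≡ true → within (suc k) v ≡ true
  within-step k v u a w = trans (cong (within k v ∨_) (count-nonzero _ u (cong₂ _∧_ a w))) (∨-zeroʳ (within k v))

  within-suc : ∀ k v → within (suc k) v ≡ true → within k v ≡ false → ∃ λ u → adj v u ≡ true × within k u ≡ true
  within-suc k v e f with within k v
  within-suc k v e refl | false = map₂ (∧-true _ _) (count-witness _ e)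

  pathLength : ∀ {u v} → Path adj u v → ℕ
  pathLength here       = 0
  pathLength (step _ p) = suc (pathLength p)

  within-pathLength : ∀ {v} (p : Path adj v v₀) → within (pathLength p) v ≡ true
  within-pathLength here                  = within-root
  within-pathLength {v} (step {v = w} a p) = within-step (pathLength p) v w a (within-pathLength p)

  pathBound : Fin n → ℕ
  pathBound v = pathLength (connected v v₀)

  δ : Fin n → ℕ
  δ v = leastBelow (λ k → within k v) (pathBound v)

  δ-within : ∀ v → within (δ v) v ≡ true
  δ-within v = leastBelow-holds (λ k → within k v) (pathBound v) (within-pathLength (connected v v₀))

  δ-minimal : ∀ v k → within k v ≡ true → δ v ≤ k
  δ-minimal v = leastBelow-minimal (λ k → within k v) (pathBound v)

  δ-root : δ v₀ ≡ 0
  δ-root = n≤0⇒n≡0 (δ-minimal v₀ 0 within-root)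

  δ-lipschitz : ∀ {u w} → adj u w ≡ true → δ w ≤ suc (δ u)
  δ-lipschitz {u} {w} a = δ-minimal w (suc (δ u)) (within-step (δ u) w u (adj-sym a) (δ-within u))

  δ-parent : ∀ v → v ≢ v₀ → ∃ λ w → adj v w ≡ true × suc (δ w) ≡ δ v
  δ-parent v v≢v₀ with δ v in eq
  ... | zero  = ⊥-elim (v≢v₀ (within-zero v (subst (λ k → within k v ≡ true) eq (δ-within v))))
  ... | suc k with within-suc k v (subst (λ j → within j v ≡ true) eq (δ-within v))
                                  (below-leastBelow (λ j → within j v) (pathBound v) k (subst (suc k ≤_) (sym eq) ≤-refl))
  ...   | u , a , wu =
    u , a , cong suc (≤-antisym (δ-minimal u k wu) (≤-pred (subst (_≤ suc (δ u)) eq (δ-lipschitz (adj-sym a)))))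

  δ≡0⇒root : ∀ v → δ v ≡ 0 → v ≡ v₀
  δ≡0⇒root v e with v ≟F v₀
  ... | yes v≡v₀ = v≡v₀
  ... | no v≢v₀ with δ-parent v v≢v₀
  ...   | _ , _ , e' with trans e' e
  ...     | ()

  ParentIn : (Fin n → Set) → Fin n → Set
  ParentIn Q x = ∃ λ w → adj x w ≡ true × Q w × suc (δ w) ≡ δ x

  ChildIn : (Fin n → Set) → Fin n → Set
  ChildIn Q x = ∃ λ w → adj x w ≡ true × Q w × δ w ≡ suc (δ x)

  ParentIn-map : ∀ {Q Q' : Fin n → Set} {x} → (∀ {w} → adj x w ≡ true → suc (δ w) ≡ δ x → Q w → Q' w) →
                 ParentIn Q x → ParentIn Q' x
  ParentIn-map f (w , a , q , e) = w , a , f a e q , e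

  ChildIn-map : ∀ {Q Q' : Fin n → Set} {x} → (∀ {w} → adj x w ≡ true → Q w → Q' w) → ChildIn Q x → ChildIn Q' x
  ChildIn-map f (w , a , q , e) = w , a , f a q , e

  descent-to-root : (Q : Fin n → Set) → (∀ x → x ≢ v₀ → Q x → ParentIn Q x) →
                    ∀ x → x ≢ v₀ → Q x → ∃ λ w → adj v₀ w ≡ true × Q w × δ w ≡ 1
  descent-to-root Q down x = descend (δ x) x refl
    where
    descend : ∀ k x → δ x ≡ k → x ≢ v₀ → Q x → ∃ λ w → adj v₀ w ≡ true × Q w × δ w ≡ 1
    descend zero    x e x≢v₀ q = ⊥-elim (x≢v₀ (δ≡0⇒root x e))
    descend (suc k) x e x≢v₀ q with down x x≢v₀ q
    ... | w , a , qw , ew with w ≟F v₀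
    ...   | yes refl  = x , adj-sym a , q , trans (sym ew) (cong suc δ-root)
    ...   | no w≢v₀ = descend k w (suc-injective (trans ew e)) w≢v₀ qw

module Correctness (G : Graph) (v₀ : Fin (Graph.n G)) where
  open Graph G
  open GraphFacts G
  open Distance G v₀

  -- The phase bit β distinguishes vertices still to be searched in the current phase from those done with it.
  Pending Done Labelled : Coloring G → Bool → Fin n → Set
  Pending  col β u = col u ≡ code (label (δ u)) β
  Done     col β u = col u ≡ code (label (δ u)) (not β)
  Labelled col β u = Pending col β u ⊎ Done col β u

  Legal : Coloring G → Bool → Fin n → Set
  Legal col β u = col u ≡ 0 ⊎ col u ≡ finished ⊎ Labelled col β u

  Pending⇒¬Done : ∀ {col β u} → Pending col β u → ¬ Done col β u
  Pending⇒¬Done p d = not-¬ refl (proj₂ (code-injective (trans (sym p) d)))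

  Labelled⇒≢0 : ∀ {col β u} → Labelled col β u → col u ≢ 0
  Labelled⇒≢0 (inj₁ p) z = code≢0 _ _ (trans (sym p) z)
  Labelled⇒≢0 (inj₂ d) z = code≢0 _ _ (trans (sym d) z)

  Labelled⇒≢finished : ∀ {col β u} → Labelled col β u → col u ≢ finished
  Labelled⇒≢finished (inj₁ p) z = code≢finished _ _ (trans (sym p) z)
  Labelled⇒≢finished (inj₂ d) z = code≢finished _ _ (trans (sym d) z)

  Labelled-transport : ∀ {β u} (col col' : Coloring G) → col' u ≡ col u → Labelled col β u → Labelled col' β u
  Labelled-transport _ _ e (inj₁ p) = inj₁ (trans e p)
  Labelled-transport _ _ e (inj₂ d) = inj₂ (trans e d)

  Legal-transport : ∀ {β u} (col col' : Coloring G) → col' u ≡ col u → Legal col β u → Legal col' β u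
  Legal-transport _    _    e (inj₁ z)         = inj₁ (trans e z)
  Legal-transport _    _    e (inj₂ (inj₁ f)) = inj₂ (inj₁ (trans e f))
  Legal-transport col col' e (inj₂ (inj₂ l)) = inj₂ (inj₂ (Labelled-transport col col' e l))

  weight : ℕ → ℕ
  weight 0 = 2
  weight 7 = 0
  weight _ = 1

  weight-code : ∀ l b → weight (code l b) ≡ 1
  weight-code ℓ₀ false = refl
  weight-code ℓ₁ false = refl
  weight-code ℓ₂ false = refl
  weight-code ℓ₀ true  = refl
  weight-code ℓ₁ true  = refl
  weight-code ℓ₂ true  = refl

  totalWeight : Coloring G → ℕ
  totalWeight col = sumFin λ u → weight (col u)

  pendingWeight : Bool → Label → ℕ → ℕ
  pendingWeight β l c = if (c ≡ᵇ 0) ∨ (c ≡ᵇ code l β) then 2 else 0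

  pendingWeight-pending : ∀ β l → pendingWeight β l (code l β) ≡ 2
  pendingWeight-pending false ℓ₀ = refl
  pendingWeight-pending false ℓ₁ = refl
  pendingWeight-pending false ℓ₂ = refl
  pendingWeight-pending true  ℓ₀ = refl
  pendingWeight-pending true  ℓ₁ = refl
  pendingWeight-pending true  ℓ₂ = refl

  pendingWeight-retreat : ∀ β l t → pendingWeight β l (retreatColour l β t) ≡ 0
  pendingWeight-retreat false ℓ₀ true  = refl
  pendingWeight-retreat false ℓ₁ true  = refl
  pendingWeight-retreat false ℓ₂ true  = refl
  pendingWeight-retreat true  ℓ₀ true  = refl
  pendingWeight-retreat true  ℓ₁ true  = refl
  pendingWeight-retreat true  ℓ₂ true  = refl
  pendingWeight-retreat false ℓ₀ false = refl
  pendingWeight-retreat false ℓ₁ false = refl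
  pendingWeight-retreat false ℓ₂ false = refl
  pendingWeight-retreat true  ℓ₀ false = refl
  pendingWeight-retreat true  ℓ₁ false = refl
  pendingWeight-retreat true  ℓ₂ false = refl

  phaseWeight : Bool → Coloring G → ℕ
  phaseWeight β col = sumFin λ u → pendingWeight β (label (δ u)) (col u)

  potential : Bool → ℕ → Coloring G → Fin n → ℕ
  potential β r col x = phaseWeight β col + (suc r ∸ δ x)

  totalWeight-recolor : ∀ col v c → totalWeight (recolor G col v c) + weight (col v) ≡ totalWeight col + weight c
  totalWeight-recolor col v c =
    trans (sumFin-update (λ u → weight (col u)) (λ u → weight (recolor G col v c u)) v
                         (λ u u≢v → cong weight (recolor-other col v c u u≢v)))
          (cong (λ z → totalWeight col + weight z) (recolor-same col v c))

  phaseWeight-recolor : ∀ β col v c → phaseWeight β (recolor G col v c) + pendingWeight β (label (δ v)) (col v)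
                                      ≡ phaseWeight β col + pendingWeight β (label (δ v)) c
  phaseWeight-recolor β col v c =
    trans (sumFin-update (λ u → pendingWeight β (label (δ u)) (col u))
                         (λ u → pendingWeight β (label (δ u)) (recolor G col v c u)) v
                         (λ u u≢v → cong (pendingWeight β (label (δ u))) (recolor-other col v c u u≢v)))
          (cong (λ z → phaseWeight β col + pendingWeight β (label (δ v)) z) (recolor-same col v c))

  totalWeight-recode : ∀ col v l b l' b' → col v ≡ code l b → totalWeight (recolor G col v (code l' b')) ≡ totalWeight col
  totalWeight-recode col v l b l' b' e = +-cancelʳ-≡ 1 _ _ (begin
    totalWeight col' + 1                    ≡⟨ cong (totalWeight col' +_) (weight-code l b) ⟨
    totalWeight col' + weight (code l b)    ≡⟨ cong (λ z → totalWeight col' + weight z) e ⟨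
    totalWeight col' + weight (col v)       ≡⟨ totalWeight-recolor col v (code l' b') ⟩
    totalWeight col + weight (code l' b')   ≡⟨ cong (totalWeight col +_) (weight-code l' b') ⟩
    totalWeight col + 1                     ∎)
    where
    open ≡-Reasoning
    col' = recolor G col v (code l' b')

  -- β: phase bit; r: radius already searched; m: total weight at the start of the phase.
  record Invariant (β : Bool) (r m : ℕ) (vis : List (Fin n)) (col : Coloring G) : Set where
    field
      shape            : ∀ u → Legal col β u
      ball-coloured    : ∀ u → δ u ≤ r → col u ≢ 0
      coloured-near    : ∀ u → col u ≢ 0 → δ u ≤ suc r
      pending-inside   : ∀ u → Pending col β u → δ u ≤ r
      finished-closed  : ∀ u w → col u ≡ finished → adj u w ≡ true → col w ≢ 0
      done-closed      : ∀ u w → Done col β u → δ u ≤ r → adj u w ≡ true → col w ≢ 0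
      labelled-parent  : ∀ x → x ≢ v₀ → Labelled col β x → ParentIn (Labelled col β) x
      pending-parent   : ∀ x → x ≢ v₀ → Pending col β x → ParentIn (Pending col β) x
      coloured-visited : ∀ u → col u ≢ 0 → u ∈ vis
      weight-bound     : totalWeight col ≤ m
      -- If a phase has not yet spent weight, its done vertices have done children; as depth is
      -- bounded there are then none, so a phase can only end after spending weight.
      unspent-done-child : totalWeight col ≡ m → ∀ u → Done col β u → ChildIn (Done col β) u
  open Invariant

  atOrAway : ∀ {X : Set} (u x : Fin n) → (u ≡ x → X) → (u ≢ x → X) → X
  atOrAway u x at away with u ≟F x
  ... | yes u≡x = at u≡x
  ... | no u≢x  = away u≢x

  Invariant-cong : ∀ {β r m vis col} (col' : Coloring G) w → (∀ u → col' u ≡ col u) →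
                   Invariant β r m vis col → Invariant β r m (w ∷ vis) col'
  Invariant-cong {m = m} {col = col} col' w same I = record
    { shape              = λ u → Legal-transport col col' (same u) (shape I u)
    ; ball-coloured      = λ u le z → ball-coloured I u le (trans (sym (same u)) z)
    ; coloured-near      = λ u nz → coloured-near I u (λ z → nz (trans (same u) z))
    ; pending-inside     = λ u p → pending-inside I u (trans (sym (same u)) p)
    ; finished-closed    = λ u v f a z → finished-closed I u v (trans (sym (same u)) f) a (trans (sym (same v)) z)
    ; done-closed        = λ u v d le a z → done-closed I u v (trans (sym (same u)) d) le a (trans (sym (same v)) z)
    ; labelled-parent    = λ x x≢v₀ l → ParentIn-map (λ {v} _ _ → Labelled-transport col col' (same v))
                                          (labelled-parent I x x≢v₀ (Labelled-transport col' col (sym (same x)) l))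
    ; pending-parent     = λ x x≢v₀ p → ParentIn-map (λ {v} _ _ → trans (same v))
                                          (pending-parent I x x≢v₀ (trans (sym (same x)) p))
    ; coloured-visited   = λ u nz → there (coloured-visited I u (λ z → nz (trans (same u) z)))
    ; weight-bound       = subst (_≤ m) (sym weight≡) (weight-bound I)
    ; unspent-done-child = λ e u d → ChildIn-map (λ {v} _ → trans (same v))
                                       (unspent-done-child I (trans (sym weight≡) e) u (trans (sym (same u)) d))
    }
    where
    weight≡ : totalWeight col' ≡ totalWeight col
    weight≡ = sumFin-cong (λ u → cong weight (same u))

  module Recolouring (col : Coloring G) (x : Fin n) (c : ℕ) where
    col' : Coloring G
    col' = recolor G col x c

    at-x : col' x ≡ c
    at-x = recolor-same col x c

    away : ∀ u → u ≢ x → col' u ≡ col u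
    away = recolor-other col x c

    keeps-coloured : c ≢ 0 → ∀ u → col u ≢ 0 → col' u ≢ 0
    keeps-coloured c≢0 u nz = atOrAway u x (λ { refl z → c≢0 (trans (sym at-x) z) })
                                           (λ u≢x z → nz (trans (sym (away u u≢x)) z))

    shape-recolour : ∀ {β} → (∀ u → Legal col β u) →
                     (col' x ≡ finished ⊎ Labelled col' β x) → ∀ u → Legal col' β u
    shape-recolour old new u =
      atOrAway u x (λ { refl → inj₂ new }) (λ u≢x → Legal-transport col col' (away u u≢x) (old u))

    visited-recolour : ∀ {vis} w → x ∈ vis → (∀ u → col u ≢ 0 → u ∈ vis) → ∀ u → col' u ≢ 0 → u ∈ w ∷ vis
    visited-recolour w x∈vis old u nz =
      there (atOrAway u x (λ { refl → x∈vis }) (λ u≢x → old u (λ z → nz (trans (away u u≢x) z))))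

  Invariant-discover : ∀ {β r m vis col} y w c → Invariant β r m vis col → col y ≡ 0 → δ y ≡ suc r →
                       adj y w ≡ true → Pending col β w → δ w ≡ r → y ∈ vis → c ≡ code (label (δ y)) (not β) →
                       Invariant β r m (w ∷ vis) (recolor G col y c)
  Invariant-discover {β} {r} {col = col} y w c I y-blank δy adj-yw pw δw y∈vis refl = record
    { shape              = shape-recolour (shape I) (inj₂ (inj₂ at-x))
    ; ball-coloured      = λ u le → keeps-coloured c≢0 u (ball-coloured I u le)
    ; coloured-near      = λ u nz → atOrAway u y (λ { refl → subst (_≤ suc r) (sym δy) ≤-refl })
                                                 (λ u≢y → coloured-near I u (λ z → nz (trans (away u u≢y) z)))
    ; pending-inside     = λ u p → atOrAway u y (λ { refl → ⊥-elim (Pending⇒¬Done {col'} p at-x) })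
                                                (λ u≢y → pending-inside I u (trans (sym (away u u≢y)) p))
    ; finished-closed    = λ u v f a → atOrAway u y (λ { refl → ⊥-elim (code≢finished _ _ (trans (sym at-x) f)) })
                              (λ u≢y → keeps-coloured c≢0 v (finished-closed I u v (trans (sym (away u u≢y)) f) a))
    ; done-closed        = λ u v d le a → atOrAway u y (λ { refl → ⊥-elim (<-irrefl refl (subst (_≤ r) δy le)) })
                              (λ u≢y → keeps-coloured c≢0 v (done-closed I u v (trans (sym (away u u≢y)) d) le a))
    ; labelled-parent    = labelled-parent'
    ; pending-parent     = pending-parent'
    ; coloured-visited   = visited-recolour w y∈vis (coloured-visited I)
    ; weight-bound       = ≤-trans (n≤1+n _) (≤-trans spent (weight-bound I))
    ; unspent-done-child = λ e → ⊥-elim (<-irrefl e (≤-trans spent (weight-bound I)))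
    }
    where
    open Recolouring col y c
    open ≡-Reasoning
    c≢0 : c ≢ 0
    c≢0 = code≢0 _ _
    ≢y : ∀ {v} → Labelled col β v → v ≢ y
    ≢y l refl = Labelled⇒≢0 {col} l y-blank
    spent : totalWeight col' < totalWeight col
    spent = +-suc-cancel-< _ _ 1 (begin
      totalWeight col' + 2                ≡⟨ cong (λ z → totalWeight col' + weight z) (sym y-blank) ⟩
      totalWeight col' + weight (col y)   ≡⟨ totalWeight-recolor col y c ⟩
      totalWeight col + weight c          ≡⟨ cong (totalWeight col +_) (weight-code _ _) ⟩
      totalWeight col + 1                 ∎)
    labelled-parent' : ∀ x → x ≢ v₀ → Labelled col' β x → ParentIn (Labelled col' β) x
    labelled-parent' x x≢v₀ l = atOrAway x y
      (λ { refl → w , adj-yw , inj₁ (trans (away w (≢y (inj₁ pw))) pw) , trans (cong suc δw) (sym δy) })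
      (λ x≢y → ParentIn-map (λ {v} _ _ lv → Labelled-transport col col' (away v (≢y lv)) lv)
                 (labelled-parent I x x≢v₀ (Labelled-transport col' col (sym (away x x≢y)) l)))
    pending-parent' : ∀ x → x ≢ v₀ → Pending col' β x → ParentIn (Pending col' β) x
    pending-parent' x x≢v₀ p = atOrAway x y
      (λ { refl → ⊥-elim (Pending⇒¬Done {col'} p at-x) })
      (λ x≢y → ParentIn-map (λ {v} _ _ pv → trans (away v (≢y (inj₁ pv))) pv)
                 (pending-parent I x x≢v₀ (trans (sym (away x x≢y)) p)))

  Invariant-retreat-done : ∀ {β r m vis col} x w c → Invariant β r m vis col → Pending col β x →
                           (∀ u → adj x u ≡ true → col u ≢ 0) →
                           (∀ u → adj x u ≡ true → Pending col β u → δ u ≡ suc (δ x) → ⊥) →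
                           ChildIn (Done col β) x → c ≡ code (label (δ x)) (not β) →
                           Invariant β r m (w ∷ vis) (recolor G col x c)
  Invariant-retreat-done {β} {r} {m} {col = col} x w c I px around no-pending-child done-child refl = record
    { shape              = shape-recolour (shape I) (inj₂ (inj₂ at-x))
    ; ball-coloured      = λ u le → keeps-coloured c≢0 u (ball-coloured I u le)
    ; coloured-near      = λ u nz → atOrAway u x (λ { refl → ≤-trans (pending-inside I x px) (n≤1+n r) })
                                                 (λ u≢x → coloured-near I u (λ z → nz (trans (away u u≢x) z)))
    ; pending-inside     = λ u p → atOrAway u x (λ { refl → ⊥-elim (Pending⇒¬Done {col'} p at-x) })
                                                (λ u≢x → pending-inside I u (trans (sym (away u u≢x)) p))
    ; finished-closed    = λ u v f a → atOrAway u x (λ { refl → ⊥-elim (code≢finished _ _ (trans (sym at-x) f)) })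
                              (λ u≢x → keeps-coloured c≢0 v (finished-closed I u v (trans (sym (away u u≢x)) f) a))
    ; done-closed        = λ u v d le a → keeps-coloured c≢0 v (atOrAway u x (λ { refl → around v a })
                              (λ u≢x → done-closed I u v (trans (sym (away u u≢x)) d) le a))
    ; labelled-parent    = labelled-parent'
    ; pending-parent     = pending-parent'
    ; coloured-visited   = visited-recolour w (coloured-visited I x (Labelled⇒≢0 {col} (inj₁ px))) (coloured-visited I)
    ; weight-bound       = subst (_≤ m) (sym unspent) (weight-bound I)
    ; unspent-done-child = λ e u d → atOrAway u x
        (λ { refl → ChildIn-map (λ {v} _ dv → trans (away v (≢x dv)) dv) done-child })
        (λ u≢x → ChildIn-map (λ {v} _ dv → trans (away v (≢x dv)) dv)
                   (unspent-done-child I (trans (sym unspent) e) u (trans (sym (away u u≢x)) d)))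
    }
    where
    open Recolouring col x c
    c≢0 : c ≢ 0
    c≢0 = code≢0 _ _
    ≢x : ∀ {v} → Done col β v → v ≢ x
    ≢x d refl = Pending⇒¬Done {col} px d
    unspent : totalWeight col' ≡ totalWeight col
    unspent = totalWeight-recode col x _ β _ (not β) px
    labelled-parent' : ∀ y → y ≢ v₀ → Labelled col' β y → ParentIn (Labelled col' β) y
    labelled-parent' y y≢v₀ l = atOrAway y x
      (λ { refl → ParentIn-map (λ {v} a _ lv → Labelled-transport col col' (away v (adj⇒≢ a ∘ sym)) lv)
                    (labelled-parent I x y≢v₀ (inj₁ px)) })
      (λ y≢x → ParentIn-map (λ {v} _ _ lv → atOrAway v x (λ { refl → inj₂ at-x })
                                                (λ v≢x → Labelled-transport col col' (away v v≢x) lv))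
                 (labelled-parent I y y≢v₀ (Labelled-transport col' col (sym (away y y≢x)) l)))
    pending-parent' : ∀ y → y ≢ v₀ → Pending col' β y → ParentIn (Pending col' β) y
    pending-parent' y y≢v₀ p = atOrAway y x
      (λ { refl → ⊥-elim (Pending⇒¬Done {col'} p at-x) })
      (λ y≢x → let py = trans (sym (away y y≢x)) p in
        ParentIn-map (λ {v} a e pv → atOrAway v x (λ { refl → ⊥-elim (no-pending-child y (adj-sym a) py (sym e)) })
                                                  (λ v≢x → trans (away v v≢x) pv))
                     (pending-parent I y y≢v₀ py))

  Invariant-retreat-finished : ∀ {β r m vis col} x w → Invariant β r m vis col → Pending col β x →
                               (∀ u → adj x u ≡ true → col u ≢ 0) →
                               (∀ u → adj x u ≡ true → Labelled col β u → δ u ≡ suc (δ x) → ⊥) →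
                               Invariant β r m (w ∷ vis) (recolor G col x finished)
  Invariant-retreat-finished {β} {r} {col = col} x w I px around no-labelled-child = record
    { shape              = shape-recolour (shape I) (inj₁ at-x)
    ; ball-coloured      = λ u le → keeps-coloured (λ ()) u (ball-coloured I u le)
    ; coloured-near      = λ u nz → atOrAway u x (λ { refl → ≤-trans (pending-inside I x px) (n≤1+n r) })
                                                 (λ u≢x → coloured-near I u (λ z → nz (trans (away u u≢x) z)))
    ; pending-inside     = λ u p → atOrAway u x (λ { refl → ⊥-elim (not-labelled (inj₁ p)) })
                                                (λ u≢x → pending-inside I u (trans (sym (away u u≢x)) p))
    ; finished-closed    = λ u v f a → keeps-coloured (λ ()) v (atOrAway u x (λ { refl → around v a })
                              (λ u≢x → finished-closed I u v (trans (sym (away u u≢x)) f) a))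
    ; done-closed        = λ u v d le a → atOrAway u x (λ { refl → ⊥-elim (not-labelled (inj₂ d)) })
                              (λ u≢x → keeps-coloured (λ ()) v (done-closed I u v (trans (sym (away u u≢x)) d) le a))
    ; labelled-parent    = λ y y≢v₀ l → atOrAway y x (λ { refl → ⊥-elim (not-labelled l) }) λ y≢x →
        let ly = Labelled-transport col' col (sym (away y y≢x)) l in
        ParentIn-map (λ {v} a e lv → Labelled-transport col col' (away v (≢x y (adj-sym a) ly e)) lv)
                     (labelled-parent I y y≢v₀ ly)
    ; pending-parent     = λ y y≢v₀ p → atOrAway y x (λ { refl → ⊥-elim (not-labelled (inj₁ p)) }) λ y≢x →
        let py = trans (sym (away y y≢x)) p in
        ParentIn-map (λ {v} a e pv → trans (away v (≢x y (adj-sym a) (inj₁ py) e)) pv)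
                     (pending-parent I y y≢v₀ py)
    ; coloured-visited   = visited-recolour w (coloured-visited I x (Labelled⇒≢0 {col} (inj₁ px))) (coloured-visited I)
    ; weight-bound       = ≤-trans (n≤1+n _) (≤-trans spent (weight-bound I))
    ; unspent-done-child = λ e → ⊥-elim (<-irrefl e (≤-trans spent (weight-bound I)))
    }
    where
    open Recolouring col x finished
    open ≡-Reasoning
    not-labelled : ¬ Labelled col' β x
    not-labelled l = Labelled⇒≢finished {col'} l at-x
    ≢x : ∀ y {v} → adj v y ≡ true → Labelled col β y → suc (δ v) ≡ δ y → v ≢ x
    ≢x y a ly e refl = no-labelled-child y a ly (sym e)
    spent : totalWeight col' < totalWeight col
    spent = +-suc-cancel-< _ _ 0 (begin
      totalWeight col' + 1                                ≡⟨ cong (totalWeight col' +_) (weight-code _ β) ⟨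
      totalWeight col' + weight (code (label (δ x)) β)   ≡⟨ cong (λ z → totalWeight col' + weight z) px ⟨
      totalWeight col' + weight (col x)                   ≡⟨ totalWeight-recolor col x finished ⟩
      totalWeight col + 0                                 ∎)

  only-root-pending : ∀ {β r m vis col} → Invariant β r m vis col →
                      (∀ u → adj v₀ u ≡ true → Pending col β u → δ u ≡ 1 → ⊥) → ∀ y → y ≢ v₀ → ¬ Pending col β y
  only-root-pending I no-child y y≢v₀ p with descent-to-root _ (pending-parent I) y y≢v₀ p
  ... | w , a , pw , δw = no-child w a pw δw

  ball-closed : ∀ {β r m vis col} → Invariant β r m vis col → (∀ u → adj v₀ u ≡ true → col u ≢ 0) →
                (∀ y → y ≢ v₀ → ¬ Pending col β y) → ∀ v u → δ v ≤ r → adj v u ≡ true → col u ≢ 0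
  ball-closed I around no-pending v u le a with shape I v
  ... | inj₁ z                = ⊥-elim (ball-coloured I v le z)
  ... | inj₂ (inj₁ f)        = finished-closed I v u f a
  ... | inj₂ (inj₂ (inj₂ d)) = done-closed I v u d le a
  ... | inj₂ (inj₂ (inj₁ p)) = atOrAway v v₀ (λ { refl → around u a }) (λ v≢v₀ → ⊥-elim (no-pending v v≢v₀ p))

  ball-grows : ∀ {β r m vis col} → Invariant β r m vis col → (∀ v u → δ v ≤ r → adj v u ≡ true → col u ≢ 0) →
               ∀ u → δ u ≤ suc r → col u ≢ 0
  ball-grows {r = r} I closed u le with δ u ≤? r
  ... | yes le' = ball-coloured I u le'
  ... | no  nle with δ-parent u (λ { refl → 0≢1+n (trans (sym δ-root) (≤-antisym le (≰⇒> nle))) })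
  ...   | v , a , δv = closed v u (≤-pred (subst (_≤ suc r) (sym δv) le)) (adj-sym a)

  Invariant-flip : ∀ {β r m vis col} w c → Invariant β r m vis col → Pending col β v₀ →
                   (∀ u → adj v₀ u ≡ true → col u ≢ 0) →
                   (∀ u → adj v₀ u ≡ true → Pending col β u → δ u ≡ 1 → ⊥) →
                   c ≡ code (label (δ v₀)) (not β) →
                   Invariant (not β) (suc r) (totalWeight (recolor G col v₀ c)) (w ∷ vis) (recolor G col v₀ c)
  Invariant-flip {β} {r} {col = col} w c I p₀ around no-child refl = record
    { shape              = λ u → atOrAway u v₀ (λ { refl → inj₂ (inj₂ (inj₁ at-x)) })
                                                 (λ u≢v₀ → shape' u u≢v₀ (shape I u))
    ; ball-coloured      = λ u le → keeps-coloured (code≢0 _ _) u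
                                      (ball-grows I (ball-closed I around no-pending) u le)
    ; coloured-near      = λ u nz → ≤-trans (coloured-near I u (was-coloured u nz)) (n≤1+n _)
    ; pending-inside     = λ u p → atOrAway u v₀ (λ { refl → subst (_≤ suc r) (sym δ-root) z≤n })
                                                 (λ u≢v₀ → coloured-near I u (was-coloured u (Labelled⇒≢0 {col'} (inj₁ p))))
    ; finished-closed    = λ u v f a → atOrAway u v₀ (λ { refl → ⊥-elim (code≢finished _ _ (trans (sym at-x) f)) })
                              (λ u≢v₀ → keeps-coloured (code≢0 _ _) v
                                          (finished-closed I u v (trans (sym (away u u≢v₀)) f) a))
    ; done-closed        = λ u _ d → ⊥-elim (no-done u d)
    ; labelled-parent    = λ y y≢v₀ l → ParentIn-map (λ {v} _ _ → relabel v)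
                                          (labelled-parent I y y≢v₀ (unrelabel y y≢v₀ l))
    ; pending-parent     = λ y y≢v₀ p → ParentIn-map (λ {v} _ _ lv → pending (relabel v lv))
                                          (labelled-parent I y y≢v₀ (unrelabel y y≢v₀ (inj₁ p)))
    ; coloured-visited   = λ u nz → there (coloured-visited I u (was-coloured u nz))
    ; weight-bound       = ≤-refl
    ; unspent-done-child = λ _ u d → ⊥-elim (no-done u d)
    }
    where
    open Recolouring col v₀ (code (label (δ v₀)) (not β))
    no-pending : ∀ y → y ≢ v₀ → ¬ Pending col β y
    no-pending = only-root-pending I no-child
    was-coloured : ∀ u → col' u ≢ 0 → col u ≢ 0
    was-coloured u nz = atOrAway u v₀ (λ { refl → Labelled⇒≢0 {col} (inj₁ p₀) })
                                      (λ u≢v₀ z → nz (trans (away u u≢v₀) z))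
    no-done : ∀ u → ¬ Done col' (not β) u
    no-done u d = atOrAway u v₀
      (λ { refl → not-¬ refl (proj₂ (code-injective (trans (sym at-x) d))) })
      (λ u≢v₀ → no-pending u u≢v₀ (trans (trans (sym (away u u≢v₀)) d) (cong (code _) (not-involutive β))))
    pending : ∀ {u} → Labelled col' (not β) u → Pending col' (not β) u
    pending (inj₁ p) = p
    pending {u} (inj₂ d) = ⊥-elim (no-done u d)
    relabel : ∀ u → Labelled col β u → Labelled col' (not β) u
    relabel u l = atOrAway u v₀ (λ { refl → inj₁ at-x }) λ u≢v₀ → relabel-away u≢v₀ l
      where
      relabel-away : u ≢ v₀ → Labelled col β u → Labelled col' (not β) u
      relabel-away u≢v₀ (inj₁ p) = ⊥-elim (no-pending u u≢v₀ p)
      relabel-away u≢v₀ (inj₂ d) = inj₁ (trans (away u u≢v₀) d)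
    unrelabel : ∀ y → y ≢ v₀ → Labelled col' (not β) y → Labelled col β y
    unrelabel y y≢v₀ l = inj₂ (trans (sym (away y y≢v₀)) (pending l))
    shape' : ∀ u → u ≢ v₀ → Legal col β u → Legal col' (not β) u
    shape' u u≢v₀ (inj₁ z)         = inj₁ (trans (away u u≢v₀) z)
    shape' u u≢v₀ (inj₂ (inj₁ f)) = inj₂ (inj₁ (trans (away u u≢v₀) f))
    shape' u u≢v₀ (inj₂ (inj₂ l)) = inj₂ (inj₂ (relabel u l))

  classify-code : ∀ {β r m vis col} → Invariant β r m vis col → ∀ u l b → col u ≡ code l b →
                  label (δ u) ≡ l × (b ≡ β × Pending col β u ⊎ b ≡ not β × Done col β u)
  classify-code I u l b e with shape I u
  ... | inj₁ z         = ⊥-elim (code≢0 l b (trans (sym e) z))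
  ... | inj₂ (inj₁ f) = ⊥-elim (code≢finished l b (trans (sym e) f))
  ... | inj₂ (inj₂ (inj₁ p)) with code-injective (trans (sym e) p)
  ...   | refl , refl = refl , inj₁ (refl , p)
  classify-code I u l b e | inj₂ (inj₂ (inj₂ d)) with code-injective (trans (sym e) d)
  ...   | refl , refl = refl , inj₂ (refl , d)

  absent-child : ∀ col x b → present col x (code (next (label (δ x))) b) ≡ false →
                 ∀ u → adj x u ≡ true → col u ≡ code (label (δ u)) b → δ u ≡ suc (δ x) → ⊥
  absent-child col x b e u a cu δu = ¬present⇒¬neighbour col x u _ e a (trans cu (cong (λ d → code (label d) b) δu))

  absent-root-child : ∀ col b → present col v₀ (code (next (label (δ v₀))) b) ≡ false →
                      ∀ u → adj v₀ u ≡ true → col u ≡ code (label (δ u)) b → δ u ≡ 1 → ⊥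
  absent-root-child col b e u a cu δu = absent-child col v₀ b e u a cu (trans δu (cong suc (sym δ-root)))

  labelled-move : ∀ col x {l b t₀ t₁ t₂ t₃} → col x ≡ code l b →
                  present col x 0 ≡ t₀ → present col x (code (next l) b) ≡ t₁ →
                  present col x (code (prev l) b) ≡ t₂ → present col x (code (next l) (not b)) ≡ t₃ →
                  explorerMove (col x) (env G col x) ≡ guard (env G col x) (labelledMove l b t₀ t₁ t₂ t₃)
  labelled-move col x {l} {b} e refl refl refl refl rewrite e = cong (guard _) (decide-code l b _)

  Explorable : List (Fin n) → Coloring G → Fin n → Set
  Explorable = Good G explorer v₀

  -- The run is analysed by induction on (m, k), lexicographically: m bounds the total weight at the
  -- start of the phase, k the potential inside it.
  FromPending : ℕ → ℕ → Set
  FromPending M k = ∀ β r m vis col x → m < M → potential β r col x < k →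
                    Invariant β r m vis col → Pending col β x → Explorable vis col x

  FromFresh : ℕ → ℕ → Set
  FromFresh M k = ∀ β r m vis col y → m < M → phaseWeight β col < k → Invariant β r m vis col →
                  col y ≡ 0 → y ∈ vis → (∃ λ x → adj y x ≡ true × Pending col β x) → Explorable vis col y

  NextPhase : ℕ → Set
  NextPhase M = ∀ β r m vis col x → suc m < M → Invariant β r m vis col → Pending col β x → Explorable vis col x

  phaseWeight-spend : ∀ β col v t → pendingWeight β (label (δ v)) (col v) ≡ 2 →
                      phaseWeight β (recolor G col v (retreatColour (label (δ v)) β t)) + 2 ≡ phaseWeight β col
  phaseWeight-spend β col v t two = begin
    phaseWeight β col' + 2                                    ≡⟨ cong (phaseWeight β col' +_) two ⟨
    phaseWeight β col' + pendingWeight β l (col v)            ≡⟨ phaseWeight-recolor β col v c ⟩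
    phaseWeight β col + pendingWeight β l c                   ≡⟨ cong (phaseWeight β col +_) (pendingWeight-retreat β l t) ⟩
    phaseWeight β col + 0                                     ≡⟨ +-identityʳ _ ⟩
    phaseWeight β col                                         ∎
    where
    open ≡-Reasoning
    l = label (δ v)
    c = retreatColour l β t
    col' = recolor G col v c

  blank-outside : ∀ {β r m vis col} y → Invariant β r m vis col → col y ≡ 0 → r < δ y
  blank-outside {r = r} y I y-blank with δ y ≤? r
  ... | yes le  = ⊥-elim (ball-coloured I y le y-blank)
  ... | no  nle = ≰⇒> nle

  fresh-depth : ∀ {β r m vis col} x y → Invariant β r m vis col → col y ≡ 0 → adj y x ≡ true → Pending col β x →
                δ x ≡ r × δ y ≡ suc r
  fresh-depth x y I y-blank a px = δx , ≤-antisym (subst (λ z → δ y ≤ suc z) δx δy≤) r<δy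
    where
    r<δy = blank-outside y I y-blank
    δy≤ = δ-lipschitz (adj-sym a)
    δx = ≤-antisym (pending-inside I x px) (≤-pred (≤-trans r<δy δy≤))

  fresh-parentLabel : ∀ {β r m vis col} x y → Invariant β r m vis col → col y ≡ 0 → adj y x ≡ true → Pending col β x →
                      parentLabel (λ l b → present col y (code l b)) ≡ just (label r , β)
  fresh-parentLabel {β} {r} {col = col} x y I y-blank a px =
    parentLabel-unique _ (label r) β
      (neighbour⇒present col y x _ a (subst (λ d → col x ≡ code (label d) β) (proj₁ (fresh-depth x y I y-blank a px)) px))
      only
    where
    only : ∀ l b → present col y (code l b) ≡ true → (l , b) ≡ (label r , β) ⊎ (l , b) ≡ (next (label r) , not β)
    only l b e with present⇒neighbour col y (code l b) e
    ... | u , a' , cu with classify-code I u l b cu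
                         | ≤∧≤1+⇒≡∨≡1+ (≤-pred (≤-trans (blank-outside y I y-blank) (δ-lipschitz (adj-sym a'))))
                                      (coloured-near I u (λ z → code≢0 l b (trans (sym cu) z)))
    ...   | refl , inj₁ (refl , pu) | inj₁ δu = inj₁ (cong (_, β) (cong label δu))
    ...   | refl , inj₁ (refl , pu) | inj₂ δu = ⊥-elim (<-irrefl δu (s≤s (pending-inside I u pu)))
    ...   | refl , inj₂ (refl , du) | inj₁ δu =
      ⊥-elim (done-closed I u y du (subst (_≤ r) (sym δu) ≤-refl) (adj-sym a') y-blank)
    ...   | refl , inj₂ (refl , du) | inj₂ δu = inj₂ (cong (_, not β) (cong label δu))

  explore-fresh : ∀ M k → FromPending M k → FromFresh M (suc k)
  explore-fresh M k from-pending β r m vis col y m<M pw<1+k I y-blank y∈vis (x , a , px) = go moves continue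
    where
    δx,δy = fresh-depth x y I y-blank a px
    c = code (next (label r)) (not β)
    moves : explorerMove (col y) (env G col y) ≡ just (c , code (label r) β)
    moves rewrite y-blank | fresh-parentLabel x y I y-blank a px =
      guard-pass (env G col y) c _
        (neighbour⇒present col y x _ a (subst (λ d → col x ≡ code (label d) β) (proj₁ δx,δy) px))
        (code-inPalette (next (label r)) (not β))
    continue : ∀ w → adj y w ≡ true → col w ≡ code (label r) β → Explorable (w ∷ vis) (recolor G col y c) w
    continue w a' cw = from-pending β r m (w ∷ vis) col' w m<M potential< I' (trans (away w w≢y) pw)
      where
      open Recolouring col y c
      w≢y = adj⇒≢ a' ∘ sym
      δw : δ w ≡ r
      δw = label-≡ (δ w) r (coloured-near I w (λ z → code≢0 _ _ (trans (sym cw) z)))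
                   (≤-trans (≤-pred (≤-trans (blank-outside y I y-blank) (δ-lipschitz (adj-sym a')))) (n≤1+n _))
                   (proj₁ (classify-code I w _ β cw))
      pw : Pending col β w
      pw = subst (λ d → col w ≡ code (label d) β) (sym δw) cw
      I' = Invariant-discover y w c I y-blank (proj₂ δx,δy) a' pw δw y∈vis
                              (cong (λ d → code (label d) (not β)) (sym (proj₂ δx,δy)))
      spent : phaseWeight β col' + 2 ≡ phaseWeight β col
      spent = subst (λ d → phaseWeight β (recolor G col y (retreatColour (label d) β true)) + 2 ≡ phaseWeight β col)
                    (proj₂ δx,δy) (phaseWeight-spend β col y true (cong (pendingWeight β _) y-blank))
      potential< : potential β r col' w < k
      potential< rewrite δw | m+n∸n≡m 1 r = spend-two _ _ 0 k spent (subst (_< suc k) (sym (+-identityʳ _)) pw<1+k)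

  phase-spent : ∀ {β r m vis col} w → Invariant β r m vis col → Done col β w → totalWeight col < m
  phase-spent {β} {r} {m} {col = col} w I dw with totalWeight col ≟ℕ m
  ... | no  ≢m = ≤∧≢⇒< (weight-bound I) ≢m
  ... | yes ≡m = ⊥-elim (no-ascending-chain δ (Done col β) (suc r) climb
                           (λ u du → coloured-near I u (Labelled⇒≢0 {col} (inj₂ du))) w dw)
    where
    climb : ∀ u → Done col β u → ∃ λ v → Done col β v × δ v ≡ suc (δ u)
    climb u du with unspent-done-child I ≡m u du
    ... | v , _ , dv , δv = v , dv , δv

  flip-at-root : ∀ M {β r m vis col} x → x ≡ v₀ → NextPhase M → m < M → Invariant β r m vis col → Pending col β x →
                 present col x 0 ≡ false → present col x (code (next (label (δ x))) β) ≡ false →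
                 present col x (code (prev (label (δ x))) β) ≡ false →
                 present col x (code (next (label (δ x))) (not β)) ≡ true → Explorable vis col x
  flip-at-root M {β} {r} {vis = vis} {col} .v₀ refl next-phase m<M I p₀ e₀ e₁ e₂ e₃ = go moves continue
    where
    l = label (δ v₀)
    c = code l (not β)
    moves : explorerMove (col v₀) (env G col v₀) ≡ just (c , code (next l) (not β))
    moves = trans (labelled-move col v₀ p₀ e₀ e₁ e₂ e₃) (guard-pass (env G col v₀) c _ e₃ (code-inPalette l (not β)))
    continue : ∀ w → adj v₀ w ≡ true → col w ≡ code (next l) (not β) → Explorable (w ∷ vis) (recolor G col v₀ c) w
    continue w a cw with classify-code I w (next l) (not β) cw
    ... | _  , inj₁ (¬β≡β , _) = ⊥-elim (not-¬ refl (sym ¬β≡β))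
    ... | lw , inj₂ (_ , dw)   =
      next-phase (not β) (suc r) (totalWeight col') (w ∷ vis) col' w next<M
                 (Invariant-flip w c I p₀ (λ u a → ¬present⇒¬neighbour col v₀ u 0 e₀ a)
                                 (absent-root-child col β e₁) refl)
                 (trans (away w (adj⇒≢ a ∘ sym)) (trans cw (cong (λ z → code z (not β)) (sym lw))))
      where
      open Recolouring col v₀ c
      next<M : suc (totalWeight col') < M
      next<M = subst (λ z → suc z < M) (sym (totalWeight-recode col v₀ l β l (not β) p₀))
                     (≤-trans (s≤s (phase-spent w I dw)) m<M)

  stop-at-root : ∀ {β r m vis col} x → x ≡ v₀ → Invariant β r m vis col → Pending col β x →
                 present col x 0 ≡ false → present col x (code (next (label (δ x))) β) ≡ false →
                 present col x (code (prev (label (δ x))) β) ≡ false →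
                 present col x (code (next (label (δ x))) (not β)) ≡ false → Explorable vis col x
  stop-at-root {β} {col = col} .v₀ refl I p₀ e₀ e₁ e₂ e₃ =
    stop (labelled-move col v₀ p₀ e₀ e₁ e₂ e₃)
         (λ u → coloured-visited I u
                  (Path-closed adj (λ u → col u ≢ 0) closed (connected v₀ u) (Labelled⇒≢0 {col} (inj₁ p₀))))
         refl
    where
    no-child : ∀ u → adj v₀ u ≡ true → Labelled col β u → δ u ≡ 1 → ⊥
    no-child u a (inj₁ pu) = absent-root-child col β e₁ u a pu
    no-child u a (inj₂ du) = absent-root-child col (not β) e₃ u a du
    closed : ∀ v u → col v ≢ 0 → adj v u ≡ true → col u ≢ 0
    closed v u nz a with shape I v
    ... | inj₁ z         = ⊥-elim (nz z)
    ... | inj₂ (inj₁ f) = finished-closed I v u f a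
    ... | inj₂ (inj₂ lv) = atOrAway v v₀ (λ { refl → ¬present⇒¬neighbour col v₀ u 0 e₀ a }) λ v≢v₀ →
      let (w , a' , lw , δw) = descent-to-root _ (labelled-parent I) v v≢v₀ lv in ⊥-elim (no-child w a' lw δw)

  module AtPending (M k : ℕ) {β r m vis col x} (m<M : m < M) (I : Invariant β r m vis col)
                   (px : Pending col β x) (Φ< : potential β r col x < suc k) where

    l : Label
    l = label (δ x)

    slack< : phaseWeight β col + suc (r ∸ δ x) < suc k
    slack< = subst (λ z → phaseWeight β col + z < suc k) (+-∸-assoc 1 (pending-inside I x px)) Φ<

    kept : Coloring G
    kept = recolor G col x (code l β)

    kept≗col : ∀ u → kept u ≡ col u
    kept≗col u = atOrAway u x (λ { refl → trans (recolor-same col x _) (sym px) }) (recolor-other col x _ u)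

    phaseWeight-kept : phaseWeight β kept ≡ phaseWeight β col
    phaseWeight-kept = sumFin-cong (λ u → cong (pendingWeight β (label (δ u))) (kept≗col u))

    to-fresh : present col x 0 ≡ true → FromFresh M k → Explorable vis col x
    to-fresh e₀ from-fresh = go moves continue
      where
      moves : explorerMove (col x) (env G col x) ≡ just (code l β , 0)
      moves = trans (labelled-move col x px e₀ refl refl refl) (guard-pass (env G col x) _ 0 e₀ (code-inPalette l β))
      continue : ∀ w → adj x w ≡ true → col w ≡ 0 → Explorable (w ∷ vis) kept w
      continue w a cw =
        from-fresh β r m (w ∷ vis) kept w m<M
                   (subst (_< k) (sym phaseWeight-kept) (≤-trans (s≤s (m≤m+n _ _)) (+-suc-<-pred _ _ _ slack<)))
                   (Invariant-cong kept w kept≗col I) (trans (kept≗col w) cw) (here refl)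
                   (x , adj-sym a , trans (kept≗col x) px)

    advance : present col x 0 ≡ false → present col x (code (next l) β) ≡ true → FromPending M k → Explorable vis col x
    advance e₀ e₁ from-pending = go moves continue
      where
      moves : explorerMove (col x) (env G col x) ≡ just (code l β , code (next l) β)
      moves = trans (labelled-move col x px e₀ e₁ refl refl) (guard-pass (env G col x) _ _ e₁ (code-inPalette l β))
      continue : ∀ w → adj x w ≡ true → col w ≡ code (next l) β → Explorable (w ∷ vis) kept w
      continue w a cw with classify-code I w (next l) β cw
      ... | _  , inj₂ (β≡¬β , _) = ⊥-elim (not-¬ refl β≡¬β)
      ... | lw , inj₁ (_ , pw)   =
        from-pending β r m (w ∷ vis) kept w m<M potential< (Invariant-cong kept w kept≗col I) (trans (kept≗col w) pw)
        where
        δw : δ w ≡ suc (δ x)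
        δw = label-next (δ w) (δ x) (δ-lipschitz a) (δ-lipschitz (adj-sym a)) lw
        potential< : potential β r kept w < k
        potential< rewrite phaseWeight-kept | δw = +-suc-<-pred _ _ _ slack<

    around-coloured : present col x 0 ≡ false → ∀ u → adj x u ≡ true → col u ≢ 0
    around-coloured e₀ u a = ¬present⇒¬neighbour col x u 0 e₀ a

    retreat-invariant : present col x 0 ≡ false → present col x (code (next l) β) ≡ false →
                        ∀ t → present col x (code (next l) (not β)) ≡ t →
                        ∀ w → Invariant β r m (w ∷ vis) (recolor G col x (retreatColour l β t))
    retreat-invariant e₀ e₁ true e₃ w =
      Invariant-retreat-done x w _ I px (around-coloured e₀) (absent-child col x β e₁) done-child refl
      where
      done-child : ChildIn (Done col β) x
      done-child with present⇒neighbour col x (code (next l) (not β)) e₃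
      ... | u , a , cu with classify-code I u (next l) (not β) cu
      ...   | _  , inj₁ (¬β≡β , _) = ⊥-elim (not-¬ refl (sym ¬β≡β))
      ...   | lu , inj₂ (_ , du)   = u , a , du , label-next (δ u) (δ x) (δ-lipschitz a) (δ-lipschitz (adj-sym a)) lu
    retreat-invariant e₀ e₁ false e₃ w = Invariant-retreat-finished x w I px (around-coloured e₀) no-labelled-child
      where
      no-labelled-child : ∀ u → adj x u ≡ true → Labelled col β u → δ u ≡ suc (δ x) → ⊥
      no-labelled-child u a (inj₁ pu) = absent-child col x β e₁ u a pu
      no-labelled-child u a (inj₂ du) = absent-child col x (not β) e₃ u a du

    retreat : ∀ t → present col x 0 ≡ false → present col x (code (next l) β) ≡ false →
              present col x (code (prev l) β) ≡ true → present col x (code (next l) (not β)) ≡ t →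
              FromPending M k → Explorable vis col x
    retreat t e₀ e₁ e₂ e₃ from-pending = go moves continue
      where
      c = retreatColour l β t
      moves : explorerMove (col x) (env G col x) ≡ just (c , code (prev l) β)
      moves = trans (labelled-move col x px e₀ e₁ e₂ e₃) (guard-pass (env G col x) c _ e₂ (retreatColour-inPalette l β t))
      continue : ∀ w → adj x w ≡ true → col w ≡ code (prev l) β → Explorable (w ∷ vis) (recolor G col x c) w
      continue w a cw with classify-code I w (prev l) β cw
      ... | _  , inj₂ (β≡¬β , _) = ⊥-elim (not-¬ refl β≡¬β)
      ... | lw , inj₁ (_ , pw)   =
        from-pending β r m (w ∷ vis) col' w m<M potential< (retreat-invariant e₀ e₁ t e₃ w) (trans (away w w≢x) pw)
        where
        open Recolouring col x c
        open ≡-Reasoning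
        w≢x = adj⇒≢ a ∘ sym
        δw : suc (δ w) ≡ δ x
        δw = label-prev (δ w) (δ x) (δ-lipschitz a) (δ-lipschitz (adj-sym a)) lw
        δx≤r = pending-inside I x px
        slack-grows : suc r ∸ δ w ≡ suc (suc (r ∸ δ x))
        slack-grows = begin
          suc r ∸ δ w          ≡⟨ +-∸-assoc 1 (≤-trans (n≤1+n _) (subst (_≤ r) (sym δw) δx≤r)) ⟩
          suc (r ∸ δ w)        ≡⟨ cong (λ d → suc (suc r ∸ d)) δw ⟩
          suc (suc r ∸ δ x)    ≡⟨ cong suc (+-∸-assoc 1 δx≤r) ⟩
          suc (suc (r ∸ δ x))  ∎
        spent : phaseWeight β col' + 2 ≡ phaseWeight β col
        spent = phaseWeight-spend β col x t (trans (cong (pendingWeight β l) px) (pendingWeight-pending β l))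
        potential< : potential β r col' w < k
        potential< = subst (λ z → phaseWeight β col' + z < k) (sym slack-grows) (spend-two _ _ _ k spent slack<)

    at-root : present col x (code (prev l) β) ≡ false → x ≡ v₀
    at-root e₂ with x ≟F v₀
    ... | yes x≡v₀ = x≡v₀
    ... | no  x≢v₀ with pending-parent I x x≢v₀ px
    ...   | w , a , pw , δw = ⊥-elim (¬present⇒¬neighbour col x w _ e₂ a (trans pw (cong (λ z → code z β) lw)))
      where
      lw : label (δ w) ≡ prev l
      lw = trans (sym (prev-next (label (δ w)))) (cong (λ d → prev (label d)) δw)

  explore-pending : ∀ M k → FromPending M k → FromFresh M k → NextPhase M → FromPending M (suc k)
  explore-pending M k from-pending from-fresh next-phase β r m vis col x m<M Φ< I px = dispatch _ _ _ _ refl refl refl refl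
    where
    open AtPending M k m<M I px Φ<
    dispatch : ∀ t₀ t₁ t₂ t₃ → present col x 0 ≡ t₀ → present col x (code (next l) β) ≡ t₁ →
               present col x (code (prev l) β) ≡ t₂ → present col x (code (next l) (not β)) ≡ t₃ → Explorable vis col x
    dispatch true  _     _     _     e₀ _  _  _  = to-fresh e₀ from-fresh
    dispatch false true  _     _     e₀ e₁ _  _  = advance e₀ e₁ from-pending
    dispatch false false true  t     e₀ e₁ e₂ e₃ = retreat t e₀ e₁ e₂ e₃ from-pending
    dispatch false false false true  e₀ e₁ e₂ e₃ = flip-at-root M x (at-root e₂) next-phase m<M I px e₀ e₁ e₂ e₃
    dispatch false false false false e₀ e₁ e₂ e₃ = stop-at-root x (at-root e₂) I px e₀ e₁ e₂ e₃

  mutual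
    from-pending : ∀ M k → FromPending M k
    from-pending zero    k       β r m vis col x () _  I px
    from-pending (suc M) zero    β r m vis col x _  () I px
    from-pending (suc M) (suc k) =
      explore-pending (suc M) k (from-pending (suc M) k) (from-fresh (suc M) k)
        (λ β r m vis col x 1+m<1+M I px →
           from-pending M (suc (potential β r col x)) β r m vis col x (≤-pred 1+m<1+M) ≤-refl I px)

    from-fresh : ∀ M k → FromFresh M k
    from-fresh zero    k       β r m vis col y () _  I y-blank y∈vis px
    from-fresh (suc M) zero    β r m vis col y _  () I y-blank y∈vis px
    from-fresh (suc M) (suc k) = explore-fresh (suc M) k (from-pending (suc M) k)

  blank : Coloring G
  blank _ = 0

  module Start where
    open Recolouring blank v₀ (code ℓ₀ false)

    p₀ : Pending col' false v₀
    p₀ = trans at-x (cong (λ d → code (label d) false) (sym δ-root))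

    unlabelled : ∀ {β u} → u ≢ v₀ → ¬ Labelled col' β u
    unlabelled u≢v₀ l = Labelled⇒≢0 {col'} l (away _ u≢v₀)

    initial-invariant : ∀ w → Invariant false 0 (totalWeight col') (w ∷ v₀ ∷ []) col'
    initial-invariant w = record
      { shape              = λ u → atOrAway u v₀ (λ { refl → inj₂ (inj₂ (inj₁ p₀)) }) (λ u≢v₀ → inj₁ (away u u≢v₀))
      ; ball-coloured      = λ u le → atOrAway u v₀ (λ { refl → Labelled⇒≢0 {col'} (inj₁ p₀) })
                                                    (λ u≢v₀ → ⊥-elim (u≢v₀ (δ≡0⇒root u (n≤0⇒n≡0 le))))
      ; coloured-near      = λ u nz → atOrAway u v₀ (λ { refl → subst (_≤ 1) (sym δ-root) z≤n })
                                                    (λ u≢v₀ → ⊥-elim (nz (away u u≢v₀)))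
      ; pending-inside     = λ u p → atOrAway u v₀ (λ { refl → subst (_≤ 0) (sym δ-root) z≤n })
                                                   (λ u≢v₀ → ⊥-elim (unlabelled u≢v₀ (inj₁ p)))
      ; finished-closed    = λ u v f → atOrAway u v₀ (λ { refl → ⊥-elim (code≢finished ℓ₀ false (trans (sym at-x) f)) })
                                                     (λ u≢v₀ → ⊥-elim (0≢1+n (trans (sym (away u u≢v₀)) f)))
      ; done-closed        = λ u v d → ⊥-elim (undone u d)
      ; labelled-parent    = λ x x≢v₀ l → ⊥-elim (unlabelled x≢v₀ l)
      ; pending-parent     = λ x x≢v₀ p → ⊥-elim (unlabelled x≢v₀ (inj₁ p))
      ; coloured-visited   = λ u nz → atOrAway u v₀ (λ { refl → there (here refl) }) (λ u≢v₀ → ⊥-elim (nz (away u u≢v₀)))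
      ; weight-bound       = ≤-refl
      ; unspent-done-child = λ _ u d → ⊥-elim (undone u d)
      }
      where
      undone : ∀ u → ¬ Done col' false u
      undone u d = atOrAway u v₀ (λ { refl → Pending⇒¬Done {col'} p₀ d }) (λ u≢v₀ → unlabelled u≢v₀ (inj₂ d))

    no-labels : parentLabel (λ l b → present blank v₀ (code l b)) ≡ nothing
    no-labels = parentLabel-none _ λ l b →
      ¬neighbour⇒¬present blank v₀ (code l b) (λ u _ 0≡code → code≢0 l b (sym 0≡code))

    start : Explorable (v₀ ∷ []) blank v₀
    start with present blank v₀ 0 in e₀
    ... | true  = go moves continue
      where
      moves : explorerMove 0 (env G blank v₀) ≡ just (code ℓ₀ false , 0)
      moves rewrite no-labels | e₀ = guard-pass (env G blank v₀) (code ℓ₀ false) 0 e₀ refl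
      continue : ∀ w → adj v₀ w ≡ true → blank w ≡ 0 → Explorable (w ∷ v₀ ∷ []) col' w
      continue w a _ = from-fresh (suc (totalWeight col')) (suc (phaseWeight false col')) false 0 (totalWeight col')
                         (w ∷ v₀ ∷ []) col' w ≤-refl ≤-refl (initial-invariant w) (away w (adj⇒≢ a ∘ sym)) (here refl)
                         (v₀ , adj-sym a , p₀)
    ... | false = stop moves (λ u → isolated (connected v₀ u)) refl
      where
      moves : explorerMove 0 (env G blank v₀) ≡ nothing
      moves rewrite no-labels | e₀ = refl
      isolated : ∀ {u} → Path adj v₀ u → u ∈ v₀ ∷ []
      isolated here       = here refl
      isolated (step a _) = ⊥-elim (¬present⇒¬neighbour blank v₀ _ 0 e₀ a refl)

theorem11 : Σ Algorithm λ A → Σ (Fin 7 → ℕ) λ S →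
              (∀ i → ¬ (S i ≡ 0)) × UsesOnly A S × (∀ (G : Graph) → Explores G A)
theorem11 = explorer , palette , (λ _ ()) , explorer-usesOnly-palette , λ G v₀ → Correctness.Start.start G v₀
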